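{- If $N>2$, then $N\cdot *\ne 0$, where $N\cdot *$ is the disjunctive sum of $N$ copies of the nim-heap $*=\{0\}$ and $0=\{\}$.
   Context: All games are short impartial games (identified with the finite set of their options, no infinite runs); $+$ is the disjunctive sum. There are $N$ players moving cyclically; under normal play the player unable to move on their turn is the unique loser. Relative to a position the players are $\mathbf N=\mathbf O_0,\mathbf O_1,\dots,\mathbf O_{N-2},\mathbf P=\mathbf O_{N-1}$ ($\mathbf O_i$ moves $i$ turns after $\mathbf N$), and the outcome $o(G)$ is defined recursively: $\mathbf N\in o(G)$ iff some option $G'$ has $\mathbf P\in o(G')$; for $1\le i\le N-1$, $\mathbf O_i\in o(G)$ iff every option $G'$ has $\mathbf O_{i-1}\in o(G')$. Two games are equal, $G=H$, if $o(G+X)=o(H+X)$ for all impartial games $X$. -}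

module Defs where

open import Data.Nat using (ℕ; zero; suc; _+_; _∸_)
open import Data.Fin using (Fin; toℕ; splitAt)
open import Data.Sum using (_⊎_; inj₁; inj₂; [_,_]′)
open import Data.Product using (Σ)
open import Function.Bundles using (_⇔_)

-- A short impartial game, given by its (finitely many) options.
data Game : Set where
  mk : (n : ℕ) → (Fin n → Game) → Game

𝟘 : Game
𝟘 = mk 0 (λ ())

star : Game
star = mk 1 (λ _ → 𝟘)

_⊕_ : Game → Game → Game
mk n f ⊕ mk m g = mk (n + m) λ k → [ (λ i → f i ⊕ mk m g) , (λ j → mk n f ⊕ g j) ]′ (splitAt n k)

infixl 6 _⊕_

_·_ : ℕ → Game → Game
zero · G = 𝟘
suc k · G = G ⊕ (k · G)

-- In an N-player game, player O_i (i turns after N = O_0; P = O_{N-1})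
-- belongs to the outcome o(G):
--   O_0 ∈ o(G)      iff some option G' has O_{N-1} ∈ o(G')
--   O_{i+1} ∈ o(G)  iff every option G' has O_i ∈ o(G')
InOutcome : (N : ℕ) → Game → ℕ → Set
InOutcome N (mk n f) zero    = Σ (Fin n) λ k → InOutcome N (f k) (N ∸ 1)
InOutcome N (mk n f) (suc i) = (k : Fin n) → InOutcome N (f k) i

GameEq : (N : ℕ) → Game → Game → Set
GameEq N G H = (X : Game) (i : Fin N) →
  InOutcome N (G ⊕ X) (toℕ i) ⇔ InOutcome N (H ⊕ X) (toℕ i)

module Submission where

-- Call a game /exact of length L/ if every maximal play of it has
-- exactly L moves.  In such a game the player stuck at the end is O_(L mod N),
-- so that player never belongs to the outcome (`exact-outcome`).  Exactness is
-- additive under disjunctive sum, hence k·* is exact of length k.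
--
-- Write N = n + 3 and let C = (N-1)·*, Y = {0, C}, X = {Y}.  Player O_1 is in
-- o(0 + X): the only move leads to Y, from which the next player can move to 0,
-- leaving the player after that stuck.  But O_1 is not in o(N·* + X): after the
-- move N·* + X → (N-1)·* + X, every continuation that player O_0 might choose
-- (playing in (N-1)·* or in X) can be answered so that the rest of the game is
-- exact of a length whose stuck player is the one O_0 needed to be winning.

open import Defs
open import Data.Nat using (ℕ; zero; suc; _+_; _∸_; _>_; s≤s)
open import Data.Nat.Properties using (+-suc)
open import Data.Fin using (Fin; splitAt; _↑ˡ_; _↑ʳ_)
import Data.Fin as Fin
open import Data.Fin.Properties using (splitAt-↑ˡ; splitAt-↑ʳ)
open import Data.Sum using (_⊎_; inj₁; inj₂; [_,_]′)
open import Data.Product using (Σ; _×_; _,_; proj₂)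
open import Data.Empty using (⊥; ⊥-elim)
open import Data.Unit using (⊤; tt)
open import Function.Bundles using (Equivalence)
open import Relation.Nullary using (¬_)
open import Relation.Binary.PropositionalEquality using (subst; sym)

sumOption : ∀ {a b} → (Fin a → Game) → (Fin b → Game) → Fin a ⊎ Fin b → Game
sumOption {a} {b} f g = [ (λ i → f i ⊕ mk b g) , (λ j → mk a f ⊕ g j) ]′

⊕-options-elim : ∀ {a b} (f : Fin a → Game) (g : Fin b → Game) (P : Game → Set) →
  (∀ i → P (f i ⊕ mk b g)) → (∀ j → P (mk a f ⊕ g j)) →
  ∀ k → P (sumOption f g (splitAt a k))
⊕-options-elim {a} f g P left right k with splitAt a k
... | inj₁ i = left i
... | inj₂ j = right j

module SumOutcome (N : ℕ) where

  outcome-rightMove : ∀ {i b} (G : Game) (g : Fin b → Game) (j : Fin b) →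
    InOutcome N (G ⊕ mk b g) (suc i) → InOutcome N (G ⊕ g j) i
  outcome-rightMove {i} {b} (mk a f) g j all =
    subst (λ s → InOutcome N (sumOption f g s) i) (splitAt-↑ʳ a b j) (all (a ↑ʳ j))

  outcome-leftMove : ∀ {i a b} (f : Fin a → Game) (g : Fin b → Game) (j : Fin a) →
    InOutcome N (mk a f ⊕ mk b g) (suc i) → InOutcome N (f j ⊕ mk b g) i
  outcome-leftMove {i} {a} {b} f g j all =
    subst (λ s → InOutcome N (sumOption f g s) i) (splitAt-↑ˡ a j b) (all (j ↑ˡ b))

  outcome-firstMove : ∀ {a b} (f : Fin a → Game) (g : Fin b → Game) →
    InOutcome N (mk a f ⊕ mk b g) 0 →
    (Σ (Fin a) λ i → InOutcome N (f i ⊕ mk b g) (N ∸ 1)) ⊎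
    (Σ (Fin b) λ j → InOutcome N (mk a f ⊕ g j) (N ∸ 1))
  outcome-firstMove {a} f g (k , win) =
    ⊕-options-elim f g (λ G → InOutcome N G (N ∸ 1) → _ ⊎ _)
      (λ i w → inj₁ (i , w)) (λ j w → inj₂ (j , w)) k win

Exact : Game → ℕ → Set
Exact (mk n f) zero    = Fin n → ⊥
Exact (mk n f) (suc L) = Fin n × ((k : Fin n) → Exact (f k) L)

exact-⊕ : ∀ G H a b → Exact G a → Exact H b → Exact (G ⊕ H) (a + b)
exact-⊕ (mk n f) (mk m g) zero zero endG endH =
  ⊕-options-elim f g (λ _ → ⊥) endG endH
exact-⊕ (mk n f) (mk m g) zero (suc b) endG (h , exH) = n ↑ʳ h ,
  ⊕-options-elim f g (λ G → Exact G b)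
    (λ i → ⊥-elim (endG i)) (λ j → exact-⊕ (mk n f) (g j) zero b endG (exH j))
exact-⊕ (mk n f) (mk m g) (suc a) zero (k , exG) endH = k ↑ˡ m ,
  ⊕-options-elim f g (λ G → Exact G (a + zero))
    (λ i → exact-⊕ (f i) (mk m g) a zero (exG i) endH) (λ j → ⊥-elim (endH j))
exact-⊕ (mk n f) (mk m g) (suc a) (suc b) (k , exG) (h , exH) = k ↑ˡ m ,
  ⊕-options-elim f g (λ G → Exact G (a + suc b))
    (λ i → exact-⊕ (f i) (mk m g) a (suc b) (exG i) (h , exH))
    (λ j → subst (Exact (mk n f ⊕ g j)) (sym (+-suc a b))
                 (exact-⊕ (mk n f) (g j) (suc a) b (k , exG) (exH j)))

exact-stars : ∀ k → Exact (k · star) k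
exact-stars zero    = λ ()
exact-stars (suc k) = exact-⊕ star (k · star) 1 k (Fin.zero , λ _ ()) (exact-stars k)

module ExactOutcome (N : ℕ) where

  -- `Unstuck L i`: O_i is not the player left without a move after exactly
  -- L moves, i.e. i ≢ L (mod N).
  Unstuck : ℕ → ℕ → Set
  Unstuck zero    zero    = ⊥
  Unstuck zero    (suc i) = ⊤
  Unstuck (suc L) zero    = Unstuck L (N ∸ 1)
  Unstuck (suc L) (suc i) = Unstuck L i

  exact-outcome : ∀ G L i → Exact G L → InOutcome N G i → Unstuck L i
  exact-outcome (mk k f) zero    zero    end      (x , _) = end x
  exact-outcome (mk k f) zero    (suc i) end      _       = tt
  exact-outcome (mk k f) (suc L) zero    (_ , ex) (x , w) =
    exact-outcome (f x) L (N ∸ 1) (ex x) w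
  exact-outcome (mk k f) (suc L) (suc i) (y , ex) all     =
    exact-outcome (f y) L i (ex y) (all y)

  -- After j moves it is O_j's turn.
  unstuck-shift : ∀ j L → Unstuck (j + L) j → Unstuck L 0
  unstuck-shift zero    L u = u
  unstuck-shift (suc j) L u = unstuck-shift j L u

  unstuck-diag : ∀ j → ¬ Unstuck j j
  unstuck-diag zero    u = u
  unstuck-diag (suc j) u = unstuck-diag j u

stuck-period : ∀ m j → ¬ ExactOutcome.Unstuck (suc m) (j + suc m) j
stuck-period m j u = unstuck-diag m (unstuck-shift j (suc m) u)
  where open ExactOutcome (suc m)

module Distinguisher (n : ℕ) where

  N : ℕ
  N = suc (suc (suc n))

  open SumOutcome N
  open ExactOutcome N

  C : Game
  C = suc (suc n) · star

  yOptions : Fin 2 → Game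
  yOptions Fin.zero    = 𝟘
  yOptions (Fin.suc _) = C

  Y : Game
  Y = mk 2 yOptions

  X : Game
  X = mk 1 (λ _ → Y)

  toC : Fin 2
  toC = Fin.suc Fin.zero

  -- O_1 ∈ o(0 ⊕ X): after X → Y the next player moves Y → 0.
  zero-wins : InOutcome N (𝟘 ⊕ X) 1
  zero-wins _ = Fin.zero , λ ()

  -- If T lasts exactly j+1 moves, O_j ∉ o(T ⊕ C): that game lasts exactly
  -- (j+1) + (N-1) = j + N moves, so O_j is the player left stuck.
  stuck-after-C : ∀ T j → Exact T (suc j) → ¬ InOutcome N (T ⊕ C) j
  stuck-after-C T j exT win =
    stuck-period (suc (suc n)) j
      (subst (λ L → Unstuck L j) (sym (+-suc j (suc (suc n))))
        (exact-outcome (T ⊕ C) _ j (exact-⊕ T C (suc j) _ exT (exact-stars _)) win))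

  -- If T lasts exactly N-1 moves, O_0 ∉ o(T ⊕ X): a move T → T' is answered
  -- by X → Y → C (leaving T' ⊕ C at O_n's turn), a move X → Y by Y → C
  -- (leaving T ⊕ C at O_(n+1)'s turn).
  first-loses : ∀ T → Exact T (suc (suc n)) → ¬ InOutcome N (T ⊕ X) 0
  first-loses (mk a t) exT win with outcome-firstMove t (λ _ → Y) win
  ... | inj₁ (i , afterT) =
    stuck-after-C (t i) n (proj₂ exT i)
      (outcome-rightMove (t i) yOptions toC
        (outcome-rightMove (t i) (λ _ → Y) Fin.zero afterT))
  ... | inj₂ (_ , afterX) =
    stuck-after-C (mk a t) (suc n) exT (outcome-rightMove (mk a t) yOptions toC afterX)

  -- If S lasts exactly N moves, O_1 ∉ o(S ⊕ X): answer by a move S → S',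
  -- which leaves a game S' of exact length N-1.
  second-loses : ∀ S → Exact S N → ¬ InOutcome N (S ⊕ X) 1
  second-loses (mk a s) (k , exS) all =
    first-loses (s k) (exS k) (outcome-leftMove s (λ _ → Y) k all)

mainTheorem9 : (N : ℕ) → N > 2 → ¬ GameEq N (N · star) 𝟘
mainTheorem9 (suc (suc (suc n))) (s≤s (s≤s (s≤s _))) eq =
  second-loses (N · star) (exact-stars N)
    (Equivalence.from (eq X (Fin.suc Fin.zero)) zero-wins)
  where open Distinguisher n
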